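{- Let $n\ge2$ and $1\le p\le n-1$. A permutation $\pi\in S_n$ is a $p$-resultant permutation if and only if $(\pi_1,\dots,\pi_{n-p})$ is a permutation of $[n-p]$, i.e. $\{\pi_1,\dots,\pi_{n-p}\}=\{1,\dots,n-p\}$.
   Context: Sites $L_{n-1}=\{0,1,\dots,n\}$. $\mathcal{S}(n-1,p)$ is the set of configurations of $n$ chips labeled $1,\dots,n$ with one chip on each of sites $1,\dots,n-1$ plus an extra chip on site $p$. Toppling: while some site has at least two chips, pick such a site $i$, pick two chips $\alpha<\beta$ there, move $\alpha$ to $i-1$ and $\beta$ to $i+1$. The final configuration is independent of choices and has one chip on each site but one; reading the chips left to right yields a permutation in $S_n$, and $C$ is said to topple to that permutation. $\pi\in S_n$ is $p$-resultant if some $C\in\mathcal{S}(n-1,p)$ topples to $\pi$. -}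

module Defs where

open import Data.Nat using (ℕ; zero; suc; _∸_; _<_)
open import Data.Fin using (Fin; toℕ)
import Data.Fin as F
open import Data.Vec using (Vec; lookup; _[_]≔_; toList)
open import Data.List using (List; _∷_; map; upTo)
open import Data.List.Relation.Binary.Permutation.Propositional using (_↭_)
open import Data.Fin.Permutation using (Permutation′; _⟨$⟩ʳ_)
open import Data.Product using (Σ; _×_; ∃)
open import Relation.Binary.PropositionalEquality using (_≡_)
open import Relation.Binary.Construct.Closure.ReflexiveTransitive using (Star)

-- A configuration of n chips: chips are labelled by Fin n
-- (chip index k stands for the label k+1; the order of labels is the
-- order on Fin n); the configuration records the site (a natural number,
-- sites of L_{n-1} being 0..n) of each chip.
Config : ℕ → Set
Config n = Vec ℕ n

-- C ∈ 𝒮(n-1,p): one chip on each of sites 1..n-1 plus an extra one on p,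
-- i.e. the multiset of occupied sites is {1,...,n-1} ⊎ {p}.
InS : (n p : ℕ) → Config n → Set
InS n p C = toList C ↭ (p ∷ map suc (upTo (n ∸ 1)))

data Topple {n : ℕ} : Config n → Config n → Set where
  topple : (C : Config n) (α β : Fin n) (s : ℕ) →
           α F.< β → lookup C α ≡ suc s → lookup C β ≡ suc s →
           Topple C ((C [ α ]≔ s) [ β ]≔ suc (suc s))

Topples* : {n : ℕ} → Config n → Config n → Set
Topples* = Star Topple

Stable : {n : ℕ} → Config n → Set
Stable {n} C = (α β : Fin n) → lookup C α ≡ lookup C β → α ≡ β

-- Reading the chips of a configuration from left to right gives the
-- permutation π (π ⟨$⟩ʳ j is the (j+1)-st chip from the left).
ReadsAs : {n : ℕ} → Config n → Permutation′ n → Set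
ReadsAs {n} C π = (j k : Fin n) → j F.< k →
  lookup C (π ⟨$⟩ʳ j) < lookup C (π ⟨$⟩ʳ k)

TopplesTo : {n : ℕ} → Config n → Permutation′ n → Set
TopplesTo C π = Σ _ λ D → Topples* C D × Stable D × ReadsAs D π

Resultant : (n p : ℕ) → Permutation′ n → Set
Resultant n p π = Σ (Config n) λ C → InS n p C × TopplesTo C π

-- {π_1,...,π_{n-p}} = {1,...,n-p}  (0-based indices/labels).
PrefixIsInitial : (n p : ℕ) → Permutation′ n → Set
PrefixIsInitial n p π =
  ((j : Fin n) → toℕ j < n ∸ p → toℕ (π ⟨$⟩ʳ j) < n ∸ p) ×
  ((m : Fin n) → toℕ m < n ∸ p → Σ (Fin n) λ j → toℕ j < n ∸ p × π ⟨$⟩ʳ j ≡ m)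

-- Write N y for the number of chips on the sites 0, …, y, and call y tight when N y = y and
-- loose otherwise.  Along the toppling y ≤ N y ≤ y + 1 for y ≤ n, and a toppling at site s + 1
-- only exchanges the tight y = s with the loose y = s + 1.  With h = n - p, call the labels
-- below h low and the others high.  The invariant is that the high chips on the sites ≤ x are
-- at most the tight y < x, and the low chips on the sites ≥ z are at most the loose y with
-- z ≤ y < n.  It holds initially, where the tight y are those below p, and survives a
-- toppling because of the two chips fired the smaller is high only if the larger is, and the
-- larger is low only if the smaller is.  In a stable configuration the tight y form a final
-- segment, so a high chip to the left of a low chip would leave the low chip no loose y: the
-- h low labels are read first.  Conversely, when they are, the configuration with the high
-- chips on 1, …, p and the low ones on p, …, n - 1 is fired into the sorted one by moving the
-- high chips, rightmost first, across all the low chips.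
module Submission where

open import Data.Fin as Fin using (Fin; zero; suc; toℕ; punchIn; punchOut; fromℕ<; inject≤)
import Data.Fin.Properties as Finₚ
open import Data.Fin.Permutation as Perm using (Permutation; Permutation′; _⟨$⟩ʳ_; _⟨$⟩ˡ_; inverseˡ; inverseʳ)
open import Data.List as List using (List; applyUpTo)
import Data.List.Properties as List
open import Data.List.Relation.Binary.Permutation.Propositional
  using (_↭_; ↭-refl; ↭-prep; ↭-swap; ↭-trans; module PermutationReasoning)
open import Data.List.Relation.Binary.Permutation.Propositional.Properties using (map⁺; ++-comm; shift)
open import Data.Nat using (ℕ; zero; suc; _+_; _*_; _∸_; _⊓_; _≤_; _<_; z≤n; s≤s; _≤?_; _<?_; _≟_)
open import Data.Nat.ListAction using () renaming (sum to listSum)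
open import Data.Nat.ListAction.Properties using (sum-↭)
open import Data.Nat.Properties
open import Algebra.Properties.CommutativeMonoid.Sum +-0-commutativeMonoid
  using (sum; sum-remove; ∑-distrib-+; sum-cong-≗)
open import Algebra.Properties.CommutativeSemigroup +-commutativeSemigroup using (interchange)
open import Data.Nat.Tactic.RingSolver using (solve-∀)
open import Data.Product using (_×_; _,_; ∃; proj₁; proj₂)
open import Data.Sum using (inj₁; inj₂)
open import Data.Vec as Vec using ([]; _∷_; lookup; _[_]≔_; toList)
open import Data.Vec.Properties using (lookup∘update; lookup∘update′; lookup∘tabulate; tabulate∘lookup; tabulate-cong)
open import Function using (_∘_)
open import Function.Bundles using (Injection; _⇔_; mk⇔)
open import Function.Properties.Inverse using (↔⇒↣)
open import Relation.Binary.Construct.Closure.ReflexiveTransitive using (ε; _◅_; _◅◅_)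
open import Relation.Binary.Definitions using (tri<; tri≈; tri>)
open import Relation.Binary.PropositionalEquality
open import Relation.Nullary using (Dec; yes; no; ¬_; contradiction)

open import Defs

𝟙 : {P : Set} → Dec P → ℕ
𝟙 (yes _) = 1
𝟙 (no _) = 0

𝟙≤1 : {P : Set} (d : Dec P) → 𝟙 d ≤ 1
𝟙≤1 (yes _) = s≤s z≤n
𝟙≤1 (no _) = z≤n

𝟙-yes : {P : Set} (d : Dec P) → P → 𝟙 d ≡ 1
𝟙-yes (yes _) _ = refl
𝟙-yes (no ¬p) p = contradiction p ¬p

𝟙-no : {P : Set} (d : Dec P) → ¬ P → 𝟙 d ≡ 0
𝟙-no (yes p) ¬p = contradiction p ¬p
𝟙-no (no _) _ = refl

𝟙-pos : {P : Set} (d : Dec P) → 1 ≤ 𝟙 d → P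
𝟙-pos (yes p) _ = p

if?_then_else_ : {P : Set} → Dec P → ℕ → ℕ → ℕ
if? yes _ then a else _ = a
if? no _ then _ else b = b

if?-yes : {P : Set} (d : Dec P) {a b : ℕ} → P → (if? d then a else b) ≡ a
if?-yes (yes _) _ = refl
if?-yes (no ¬p) p = contradiction p ¬p

if?-no : {P : Set} (d : Dec P) {a b : ℕ} → ¬ P → (if? d then a else b) ≡ b
if?-no (yes p) ¬p = contradiction p ¬p
if?-no (no _) _ = refl

sum-mono-≤ : ∀ {n} {f g : Fin n → ℕ} → (∀ i → f i ≤ g i) → sum f ≤ sum g
sum-mono-≤ {zero} _ = z≤n
sum-mono-≤ {suc n} f≤g = +-mono-≤ (f≤g zero) (sum-mono-≤ (f≤g ∘ suc))

sum≤length : ∀ {n} {f : Fin n → ℕ} → (∀ i → f i ≤ 1) → sum f ≤ n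
sum≤length {zero} _ = z≤n
sum≤length {suc n} f≤1 = +-mono-≤ (f≤1 zero) (sum≤length (f≤1 ∘ suc))

sum-zero : ∀ {n} {f : Fin n → ℕ} → (∀ i → f i ≡ 0) → sum f ≡ 0
sum-zero {zero} _ = refl
sum-zero {suc n} f≡0 = cong₂ _+_ (f≡0 zero) (sum-zero (f≡0 ∘ suc))

point≤sum : ∀ {n} (f : Fin n → ℕ) i → f i ≤ sum f
point≤sum {suc n} f i = subst (f i ≤_) (sym (sum-remove f)) (m≤m+n _ _)

pair≤sum : ∀ {n} (f : Fin n → ℕ) {i j} → i ≢ j → f i + f j ≤ sum f
pair≤sum {suc n} f {i} {j} i≢j = begin
  f i + f j                           ≡⟨ cong (λ k → f i + f k) (sym (Finₚ.punchIn-punchOut i≢j)) ⟩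
  f i + f (punchIn i (punchOut i≢j))  ≤⟨ +-monoʳ-≤ (f i) (point≤sum (f ∘ punchIn i) _) ⟩
  f i + sum (f ∘ punchIn i)           ≡⟨ sum-remove f ⟨
  sum f                               ∎
  where open ≤-Reasoning

sum-update : ∀ {n} (f g : Fin n → ℕ) i → (∀ j → j ≢ i → f j ≡ g j) → sum f + g i ≡ sum g + f i
sum-update {suc n} f g i f≗g = begin
  sum f + g i                          ≡⟨ cong (_+ g i) (sum-remove f) ⟩
  f i + sum (f ∘ punchIn i) + g i      ≡⟨ cong (λ x → f i + x + g i) (sum-cong-≗ (λ j → f≗g _ (Finₚ.punchInᵢ≢i i j))) ⟩
  f i + sum (g ∘ punchIn i) + g i      ≡⟨ +-comm (f i + _) (g i) ⟩
  g i + (f i + sum (g ∘ punchIn i))    ≡⟨ cong (g i +_) (+-comm (f i) _) ⟩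
  g i + (sum (g ∘ punchIn i) + f i)    ≡⟨ +-assoc (g i) _ (f i) ⟨
  g i + sum (g ∘ punchIn i) + f i      ≡⟨ cong (_+ f i) (sum-remove g) ⟨
  sum g + f i                          ∎
  where open ≡-Reasoning

sum≤1 : ∀ {n} {f : Fin n → ℕ} → (∀ i → f i ≤ 1) → (∀ i j → 1 ≤ f i → 1 ≤ f j → i ≡ j) → sum f ≤ 1
sum≤1 {zero} _ _ = z≤n
sum≤1 {suc n} {f} f≤1 uniq with f zero in f₀≡ | f≤1 zero
... | zero | _ = sum≤1 (f≤1 ∘ suc) (λ i j fi fj → Finₚ.suc-injective (uniq (suc i) (suc j) fi fj))
... | suc zero | _ = s≤s (≤-reflexive (sum-zero rest≡0))
  where
  rest≡0 : ∀ i → f (suc i) ≡ 0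
  rest≡0 i with f (suc i) in fᵢ≡ | f≤1 (suc i)
  ... | zero | _ = refl
  ... | suc zero | _ with () ← uniq zero (suc i) (≤-reflexive (sym f₀≡)) (≤-reflexive (sym fᵢ≡))
  ... | suc (suc _) | s≤s ()
... | suc (suc _) | s≤s ()

sum-full : ∀ {n} {f : Fin n → ℕ} → (∀ i → f i ≤ 1) → n ≤ sum f → ∀ i → f i ≡ 1
sum-full {suc n} {f} f≤1 n≤sum i with f i in fᵢ≡ | f≤1 i
... | suc zero | _ = refl
... | suc (suc _) | s≤s ()
... | zero | _ = contradiction (begin-strict
  sum f                      ≡⟨ sum-remove f ⟩
  f i + sum (f ∘ punchIn i)  ≤⟨ +-monoʳ-≤ (f i) (sum≤length (f≤1 ∘ punchIn i)) ⟩
  f i + n                    ≡⟨ cong (_+ n) fᵢ≡ ⟩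
  n                          <⟨ n<1+n n ⟩
  suc n                      ∎) (≤⇒≯ n≤sum)
  where open ≤-Reasoning

∑< : ℕ → (ℕ → ℕ) → ℕ
∑< zero f = 0
∑< (suc x) f = ∑< x f + f x

∑<-shift : ∀ x f → ∑< (suc x) f ≡ f 0 + ∑< x (f ∘ suc)
∑<-shift zero f = +-comm 0 (f 0)
∑<-shift (suc x) f = trans (cong (_+ f (suc x)) (∑<-shift x f)) (+-assoc (f 0) _ _)

sum-toℕ : ∀ n (f : ℕ → ℕ) → sum {n} (f ∘ toℕ) ≡ ∑< n f
sum-toℕ zero f = refl
sum-toℕ (suc n) f = trans (cong (f 0 +_) (sum-toℕ n (f ∘ suc))) (sym (∑<-shift n f))

∑<-cong : ∀ x {f g : ℕ → ℕ} → (∀ y → y < x → f y ≡ g y) → ∑< x f ≡ ∑< x g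
∑<-cong zero _ = refl
∑<-cong (suc x) f≗g = cong₂ _+_ (∑<-cong x (λ y y<x → f≗g y (m<n⇒m<1+n y<x))) (f≗g x ≤-refl)

∑<-mono : ∀ f {x y} → x ≤ y → ∑< x f ≤ ∑< y f
∑<-mono f {y = zero} z≤n = ≤-refl
∑<-mono f {x} {suc y} x≤1+y with m≤n⇒m<n∨m≡n x≤1+y
... | inj₁ (s≤s x≤y) = ≤-trans (∑<-mono f x≤y) (m≤m+n _ _)
... | inj₂ refl = ≤-refl

∑<-witness : ∀ x f → 1 ≤ ∑< x f → ∃ λ y → y < x × 1 ≤ f y
∑<-witness (suc x) f 1≤∑ with f x in fx≡
... | suc _ = x , ≤-refl , subst (1 ≤_) (sym fx≡) (s≤s z≤n)
... | zero with y , y<x , 1≤fy ← ∑<-witness x f (subst (1 ≤_) (+-identityʳ _) 1≤∑) = y , m<n⇒m<1+n y<x , 1≤fy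

∑<-swap : ∀ {f g : ℕ → ℕ} s → (∀ y → y ≢ s → y ≢ suc s → f y ≡ g y) → f s + f (suc s) ≡ g s + g (suc s) →
          ∀ x → x ≢ suc s → ∑< x f ≡ ∑< x g
∑<-swap s f≗g swap zero _ = refl
∑<-swap {f} {g} s f≗g swap (suc y) y≢s with y ≟ s | y ≟ suc s
... | yes refl | _ = contradiction refl y≢s
... | no _ | yes refl = begin
  ∑< s f + f s + f (suc s)    ≡⟨ +-assoc (∑< s f) _ _ ⟩
  ∑< s f + (f s + f (suc s))  ≡⟨ cong₂ _+_ (∑<-swap s f≗g swap s (λ ())) swap ⟩
  ∑< s g + (g s + g (suc s))  ≡⟨ +-assoc (∑< s g) _ _ ⟨
  ∑< s g + g s + g (suc s)    ∎
  where open ≡-Reasoning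
... | no y≢s' | no y≢ss = cong₂ _+_ (∑<-swap s f≗g swap y y≢ss) (f≗g y y≢s' y≢ss)

∑<-ones : ∀ {f : ℕ → ℕ} z d → (∀ y → z ≤ y → y < z + d → f y ≡ 1) → ∑< (z + d) f ≡ ∑< z f + d
∑<-ones z zero _ = trans (cong (λ x → ∑< x _) (+-identityʳ z)) (sym (+-identityʳ _))
∑<-ones {f} z (suc d) f≡1 = begin
  ∑< (z + suc d) f         ≡⟨ cong (λ x → ∑< x f) (+-suc z d) ⟩
  ∑< (z + d) f + f (z + d) ≡⟨ cong₂ _+_ (∑<-ones z d λ y z≤y y<z+d → f≡1 y z≤y (<-trans y<z+d z+d<z+1+d))
                                        (f≡1 (z + d) (m≤m+n z d) z+d<z+1+d) ⟩
  ∑< z f + d + 1           ≡⟨ +-assoc (∑< z f) d 1 ⟩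
  ∑< z f + (d + 1)         ≡⟨ cong (∑< z f +_) (+-comm d 1) ⟩
  ∑< z f + suc d           ∎
  where
  open ≡-Reasoning
  z+d<z+1+d : z + d < z + suc d
  z+d<z+1+d = +-monoʳ-< z (n<1+n d)

∑<-below : ∀ b x → ∑< x (λ y → 𝟙 (y <? b)) ≡ b ⊓ x
∑<-below b zero = sym (⊓-zeroʳ b)
∑<-below b (suc x) rewrite ∑<-below b x with x <? b
... | yes x<b = trans (cong (_+ 1) (m≥n⇒m⊓n≡n (<⇒≤ x<b))) (trans (+-comm x 1) (sym (m≥n⇒m⊓n≡n x<b)))
... | no x≮b = trans (+-identityʳ _)
  (trans (m≤n⇒m⊓n≡m (≮⇒≥ x≮b)) (sym (m≤n⇒m⊓n≡m (m≤n⇒m≤1+n (≮⇒≥ x≮b)))))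

∑<-atLeast : ∀ b x → ∑< x (λ y → 𝟙 (b ≤? y)) ≡ x ∸ b
∑<-atLeast b zero = sym (0∸n≡0 b)
∑<-atLeast b (suc x) rewrite ∑<-atLeast b x with b ≤? x
... | yes b≤x = trans (+-comm _ 1) (sym (+-∸-assoc 1 b≤x))
... | no b≰x = trans (+-identityʳ _) (trans (m≤n⇒m∸n≡0 (<⇒≤ (≰⇒> b≰x))) (sym (m≤n⇒m∸n≡0 (≰⇒> b≰x))))

listSum-applyUpTo : ∀ f m → listSum (applyUpTo f m) ≡ ∑< m f
listSum-applyUpTo f zero = refl
listSum-applyUpTo f (suc m) = trans (cong (f 0 +_) (listSum-applyUpTo (f ∘ suc) m)) (sym (∑<-shift m f))

toList-tabulate : ∀ {A : Set} {n} (f : Fin n → A) → toList (Vec.tabulate f) ≡ List.tabulate f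
toList-tabulate {n = zero} f = refl
toList-tabulate {n = suc n} f = cong (f zero List.∷_) (toList-tabulate (f ∘ suc))

tabulate-remove : ∀ {A : Set} {n} (t : Fin (suc n) → A) i → List.tabulate t ↭ t i List.∷ List.tabulate (t ∘ punchIn i)
tabulate-remove t zero = ↭-refl
tabulate-remove {n = suc n} t (suc i) = ↭-trans (↭-prep (t zero) (tabulate-remove (t ∘ suc) i)) (↭-swap (t zero) (t (suc i)) ↭-refl)

tabulate-permute : ∀ {A : Set} {m n} (f : Fin n → A) (σ : Permutation m n) → List.tabulate f ↭ List.tabulate (f ∘ (σ ⟨$⟩ʳ_))
tabulate-permute {m = zero} {zero} f σ = ↭-refl
tabulate-permute {m = zero} {suc n} f σ = contradiction σ (Perm.refute λ ())
tabulate-permute {m = suc m} {zero} f σ = contradiction σ (Perm.refute λ ())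
tabulate-permute {A = A} {m = suc m} {suc n} f σ = begin
  f zero List.∷ List.tabulate (f ∘ suc)
    ↭⟨ ↭-prep (f zero) (tabulate-permute (f ∘ suc) (Perm.remove (σ ⟨$⟩ˡ zero) σ)) ⟩
  f zero List.∷ List.tabulate (f ∘ suc ∘ (Perm.remove (σ ⟨$⟩ˡ zero) σ ⟨$⟩ʳ_))
    ≡⟨ cong₂ List._∷_ (cong f (sym (inverseʳ σ))) (List.tabulate-cong λ k → cong f (sym (Perm.punchIn-permute′ σ zero k))) ⟩
  σf (σ ⟨$⟩ˡ zero) List.∷ List.tabulate (σf ∘ punchIn (σ ⟨$⟩ˡ zero))
    ↭⟨ tabulate-remove σf (σ ⟨$⟩ˡ zero) ⟨
  List.tabulate σf ∎
  where
  open PermutationReasoning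
  σf : Fin (suc m) → A
  σf = f ∘ (σ ⟨$⟩ʳ_)

applyUpTo-+ : ∀ {A : Set} (f : ℕ → A) a b → applyUpTo f (a + b) ≡ applyUpTo f a List.++ applyUpTo (f ∘ (a +_)) b
applyUpTo-+ f zero b = refl
applyUpTo-+ f (suc a) b = cong (f 0 List.∷_) (applyUpTo-+ (f ∘ suc) a b)

applyUpTo-cong : ∀ {A : Set} {f g : ℕ → A} m → (∀ k → k < m → f k ≡ g k) → applyUpTo f m ≡ applyUpTo g m
applyUpTo-cong zero _ = refl
applyUpTo-cong (suc m) f≗g = cong₂ List._∷_ (f≗g 0 (s≤s z≤n)) (applyUpTo-cong m λ k k<m → f≗g (suc k) (s≤s k<m))

tabulate-toℕ : ∀ {A : Set} n (f : ℕ → A) → List.tabulate {n = n} (f ∘ toℕ) ≡ applyUpTo f n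
tabulate-toℕ zero f = refl
tabulate-toℕ (suc n) f = cong (f 0 List.∷_) (tabulate-toℕ n (f ∘ suc))

ordered-bit-absorbed : ∀ {X Y A B} → A ≤ 1 → (A ≡ 1 → B ≡ 1) → X ≤ Y → X + (A + B) ≤ suc Y → X + A ≤ Y
ordered-bit-absorbed {X} {A = zero} _ _ X≤Y _ = subst (_≤ _) (sym (+-identityʳ X)) X≤Y
ordered-bit-absorbed {X} {Y} {A = suc zero} _ B≡1 _ X+2≤1+Y rewrite B≡1 refl =
  +-cancelʳ-≤ 1 (X + 1) Y (subst₂ _≤_ (sym (+-assoc X 1 1)) (+-comm 1 Y) X+2≤1+Y)
ordered-bit-absorbed {A = suc (suc _)} (s≤s ()) _ _ _

-- Counting chips

≤[_] ≥[_] ≡[_] : ℕ → ℕ → ℕ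
≤[ x ] v = 𝟙 (v ≤? x)
≥[ z ] v = 𝟙 (z ≤? v)
≡[ x ] v = 𝟙 (v ≟ x)

≤[]-split : ∀ x v → ≤[ suc x ] v ≡ ≤[ x ] v + ≡[ suc x ] v
≤[]-split x v with v ≤? suc x | v ≤? x | v ≟ suc x
... | yes _   | yes v≤x | yes refl = contradiction v≤x (n≮n x)
... | yes _   | yes _   | no _     = refl
... | yes _   | no _    | yes _    = refl
... | yes v≤1+x | no v≰x | no v≢1+x = contradiction (≤∧≢⇒< v≤1+x v≢1+x) (λ v<1+x → v≰x (≤-pred v<1+x))
... | no v≰1+x | yes v≤x | _       = contradiction (m≤n⇒m≤1+n v≤x) v≰1+x
... | no v≰1+x | no _   | yes refl = contradiction ≤-refl v≰1+x
... | no _    | no _    | no _     = refl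

≥[]-split : ∀ z v → ≥[ z ] v ≡ ≡[ z ] v + ≥[ suc z ] v
≥[]-split z v with z ≤? v | v ≟ z | suc z ≤? v
... | yes _   | yes refl | yes z<z  = contradiction z<z (n≮n z)
... | yes _   | yes _    | no _     = refl
... | yes _   | no _     | yes _    = refl
... | yes z≤v | no v≢z   | no z≮v   = contradiction (≤∧≢⇒< z≤v (v≢z ∘ sym)) z≮v
... | no z≰v  | yes refl | _        = contradiction ≤-refl z≰v
... | no z≰v  | no _     | yes z<v  = contradiction (<⇒≤ z<v) z≰v
... | no _    | no _     | no _     = refl

≥[1+z]+≤[z]≡1 : ∀ z v → ≥[ suc z ] v + ≤[ z ] v ≡ 1
≥[1+z]+≤[z]≡1 z v with suc z ≤? v | v ≤? z
... | yes z<v | yes v≤z = contradiction (<-≤-trans z<v v≤z) (n≮n z)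
... | yes _   | no _    = refl
... | no _    | yes _   = refl
... | no z≮v  | no v≰z  = contradiction (≰⇒> v≰z) z≮v

count : ∀ {n} → Config n → (Fin n → ℕ) → (ℕ → ℕ) → ℕ
count C w q = sum λ γ → w γ * q (lookup C γ)

every : ∀ {n} → Fin n → ℕ
every _ = 1

high low : ∀ {n} → ℕ → Fin n → ℕ
high h γ = 𝟙 (h ≤? toℕ γ)
low h γ = 𝟙 (toℕ γ <? h)

chipsUpTo : ∀ {n} → Config n → ℕ → ℕ
chipsUpTo C x = count C every ≤[ x ]

highUpTo : ∀ {n} → ℕ → Config n → ℕ → ℕ
highUpTo h C x = count C (high h) ≤[ x ]

lowFrom : ∀ {n} → ℕ → Config n → ℕ → ℕ
lowFrom h C z = count C (low h) ≥[ z ]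

tight? : ∀ {n} → Config n → ℕ → ℕ
tight? C y = 𝟙 (chipsUpTo C y ≟ y)

tightBelow : ∀ {n} → Config n → ℕ → ℕ
tightBelow C x = ∑< x (tight? C)

count-cong : ∀ {n} (C : Config n) w {q q′ : ℕ → ℕ} → (∀ v → q v ≡ q′ v) → count C w q ≡ count C w q′
count-cong C w q≗q′ = sum-cong-≗ λ γ → cong (w γ *_) (q≗q′ (lookup C γ))

count-+ : ∀ {n} (C : Config n) w q q′ → count C w (λ v → q v + q′ v) ≡ count C w q + count C w q′
count-+ C w q q′ = trans (sum-cong-≗ λ γ → *-distribˡ-+ (w γ) (q (lookup C γ)) (q′ (lookup C γ)))
                         (∑-distrib-+ (λ γ → w γ * q (lookup C γ)) (λ γ → w γ * q′ (lookup C γ)))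

count-mono : ∀ {n} (C : Config n) {w w′} q → (∀ γ → w γ ≤ w′ γ) → count C w q ≤ count C w′ q
count-mono C q w≤w′ = sum-mono-≤ λ γ → *-monoˡ-≤ (q (lookup C γ)) (w≤w′ γ)

count≤length : ∀ {n} (C : Config n) {w} q → (∀ γ → w γ ≤ 1) → (∀ v → q v ≤ 1) → count C w q ≤ n
count≤length C q w≤1 q≤1 = sum≤length λ γ → *-mono-≤ (w≤1 γ) (q≤1 (lookup C γ))

count-≤[]-split : ∀ {n} (C : Config n) w x → count C w ≤[ suc x ] ≡ count C w ≤[ x ] + count C w ≡[ suc x ]
count-≤[]-split C w x = trans (count-cong C w (≤[]-split x)) (count-+ C w ≤[ x ] ≡[ suc x ])

count-≥[]-split : ∀ {n} (C : Config n) w z → count C w ≥[ z ] ≡ count C w ≡[ z ] + count C w ≥[ suc z ]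
count-≥[]-split C w z = trans (count-cong C w (≥[]-split z)) (count-+ C w ≡[ z ] ≥[ suc z ])

count-every-toList : ∀ {n} (C : Config n) q → count C every q ≡ listSum (List.map q (toList C))
count-every-toList [] q = refl
count-every-toList (v ∷ C) q = cong₂ _+_ (+-identityʳ (q v)) (count-every-toList C q)

count≤weights : ∀ {n} (C : Config n) w q → (∀ v → q v ≤ 1) → count C w q ≤ sum w
count≤weights C w q q≤1 = sum-mono-≤ λ γ → ≤-trans (*-monoʳ-≤ (w γ) (q≤1 (lookup C γ))) (≤-reflexive (*-identityʳ (w γ)))

-- One toppling

module Toppling {n} (C : Config n) (α β : Fin n) (s : ℕ) (α<β : α Fin.< β)
                 (Cα : lookup C α ≡ suc s) (Cβ : lookup C β ≡ suc s) where

  C′ : Config n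
  C′ = (C [ α ]≔ s) [ β ]≔ suc (suc s)

  α≢β : α ≢ β
  α≢β refl = n≮n _ α<β

  count-topple : ∀ w q →
    count C′ w q + (w α + w β) * q (suc s) ≡ count C w q + (w α * q s + w β * q (suc (suc s)))
  count-topple w q = begin
    ∑′ + (w α + w β) * q (suc s)  ≡⟨ cong (∑′ +_) (*-distribʳ-+ (q (suc s)) (w α) (w β)) ⟩
    ∑′ + (a + b)                  ≡⟨ cong (∑′ +_) (+-comm a b) ⟩
    ∑′ + (b + a)                  ≡⟨ +-assoc ∑′ b a ⟨
    ∑′ + b + a                    ≡⟨ cong (_+ a) second ⟩
    ∑₁ + b′ + a                   ≡⟨ +-assoc ∑₁ b′ a ⟩
    ∑₁ + (b′ + a)                 ≡⟨ cong (∑₁ +_) (+-comm b′ a) ⟩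
    ∑₁ + (a + b′)                 ≡⟨ +-assoc ∑₁ a b′ ⟨
    ∑₁ + a + b′                   ≡⟨ cong (_+ b′) first ⟩
    count C w q + a′ + b′         ≡⟨ +-assoc (count C w q) a′ b′ ⟩
    count C w q + (a′ + b′)       ∎
    where
    open ≡-Reasoning
    C₁ : Config n
    C₁ = C [ α ]≔ s
    weigh : Config n → Fin n → ℕ
    weigh D γ = w γ * q (lookup D γ)
    ∑′ ∑₁ a b a′ b′ : ℕ
    ∑′ = sum (weigh C′)
    ∑₁ = sum (weigh C₁)
    a = w α * q (suc s)
    b = w β * q (suc s)
    a′ = w α * q s
    b′ = w β * q (suc (suc s))
    at : ∀ D γ {v} → lookup D γ ≡ v → weigh D γ ≡ w γ * q v
    at D γ eq = cong (λ v → w γ * q v) eq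
    first : ∑₁ + a ≡ count C w q + a′
    first = begin
      ∑₁ + a                   ≡⟨ cong (∑₁ +_) (sym (at C α Cα)) ⟩
      ∑₁ + weigh C α           ≡⟨ sum-update (weigh C₁) (weigh C) α
                                    (λ γ γ≢α → at C₁ γ (lookup∘update′ γ≢α C s)) ⟩
      count C w q + weigh C₁ α ≡⟨ cong (count C w q +_) (at C₁ α (lookup∘update α C s)) ⟩
      count C w q + a′         ∎
    second : ∑′ + b ≡ ∑₁ + b′
    second = begin
      ∑′ + b                   ≡⟨ cong (∑′ +_) (sym (at C₁ β (trans (lookup∘update′ (α≢β ∘ sym) C s) Cβ))) ⟩
      ∑′ + weigh C₁ β          ≡⟨ sum-update (weigh C′) (weigh C₁) β
                                    (λ γ γ≢β → at C′ γ (lookup∘update′ γ≢β C₁ (suc (suc s)))) ⟩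
      ∑₁ + weigh C′ β          ≡⟨ cong (∑₁ +_) (at C′ β (lookup∘update β C₁ (suc (suc s)))) ⟩
      ∑₁ + b′                  ∎

  count-topple-values : ∀ w q {a b c} → q s ≡ a → q (suc s) ≡ b → q (suc (suc s)) ≡ c →
    count C′ w q + (w α + w β) * b ≡ count C w q + (w α * a + w β * c)
  count-topple-values w q refl refl refl = count-topple w q

  count-unchanged : ∀ w q {b} → q s ≡ b → q (suc s) ≡ b → q (suc (suc s)) ≡ b → count C′ w q ≡ count C w q
  count-unchanged w q {b} qs qs₁ qs₂ = +-cancelʳ-≡ ((w α + w β) * b) _ _
    (trans (count-topple-values w q qs qs₁ qs₂) (cong (count C w q +_) (sym (*-distribʳ-+ b (w α) (w β)))))

  s≮s : ¬ suc s ≤ s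
  s≮s = n≮n s

  2+s≰s : ¬ suc (suc s) ≤ s
  2+s≰s 2+s≤s = n≮n s (≤-trans (n≤1+n _) 2+s≤s)

  count-≤[s] : ∀ w → count C′ w ≤[ s ] ≡ count C w ≤[ s ] + w α
  count-≤[s] w = trans (sym (drop-pair _ (w α) (w β)))
    (trans (count-topple-values w ≤[ s ] (𝟙-yes (s ≤? s) ≤-refl) (𝟙-no (suc s ≤? s) s≮s) (𝟙-no (suc (suc s) ≤? s) 2+s≰s))
           (keep-first _ (w α) (w β)))
    where
    drop-pair : ∀ X a b → X + (a + b) * 0 ≡ X
    drop-pair = solve-∀
    keep-first : ∀ Z a b → Z + (a * 1 + b * 0) ≡ Z + a
    keep-first = solve-∀

  count-≤[1+s] : ∀ w → count C′ w ≤[ suc s ] + w β ≡ count C w ≤[ suc s ]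
  count-≤[1+s] w = +-cancelʳ-≡ (w α) _ _ (trans (sym (keep-pair _ (w α) (w β)))
    (trans (count-topple-values w ≤[ suc s ] (𝟙-yes (s ≤? suc s) (n≤1+n s)) (𝟙-yes (suc s ≤? suc s) ≤-refl)
                                             (𝟙-no (suc (suc s) ≤? suc s) (n≮n (suc s))))
           (keep-first _ (w α) (w β))))
    where
    keep-pair : ∀ X a b → X + (a + b) * 1 ≡ X + b + a
    keep-pair = solve-∀
    keep-first : ∀ Z a b → Z + (a * 1 + b * 0) ≡ Z + a
    keep-first = solve-∀

  count-≥[1+s] : ∀ w → count C′ w ≥[ suc s ] + w α ≡ count C w ≥[ suc s ]
  count-≥[1+s] w = +-cancelʳ-≡ (w β) _ _ (trans (sym (keep-pair _ (w α) (w β)))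
    (trans (count-topple-values w ≥[ suc s ] (𝟙-no (suc s ≤? s) s≮s) (𝟙-yes (suc s ≤? suc s) ≤-refl)
                                             (𝟙-yes (suc s ≤? suc (suc s)) (n≤1+n (suc s))))
           (keep-second _ (w α) (w β))))
    where
    keep-pair : ∀ X a b → X + (a + b) * 1 ≡ X + a + b
    keep-pair = solve-∀
    keep-second : ∀ Z a b → Z + (a * 0 + b * 1) ≡ Z + b
    keep-second = solve-∀

  count-≥[2+s] : ∀ w → count C′ w ≥[ suc (suc s) ] ≡ count C w ≥[ suc (suc s) ] + w β
  count-≥[2+s] w = trans (sym (drop-pair _ (w α) (w β)))
    (trans (count-topple-values w ≥[ suc (suc s) ] (𝟙-no (suc (suc s) ≤? s) 2+s≰s) (𝟙-no (suc (suc s) ≤? suc s) (n≮n (suc s)))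
                                                   (𝟙-yes (suc (suc s) ≤? suc (suc s)) ≤-refl))
           (keep-second _ (w α) (w β)))
    where
    drop-pair : ∀ X a b → X + (a + b) * 0 ≡ X
    drop-pair = solve-∀
    keep-second : ∀ Z a b → Z + (a * 0 + b * 1) ≡ Z + b
    keep-second = solve-∀

  count-≤[]-far : ∀ w x → x ≢ s → x ≢ suc s → count C′ w ≤[ x ] ≡ count C w ≤[ x ]
  count-≤[]-far w x x≢s x≢1+s with <-cmp x s
  ... | tri< x<s _ _ = count-unchanged w ≤[ x ] (𝟙-no (s ≤? x) (<⇒≱ x<s))
                         (𝟙-no (suc s ≤? x) (<⇒≱ (m<n⇒m<1+n x<s)))
                         (𝟙-no (suc (suc s) ≤? x) (<⇒≱ (m<n⇒m<1+n (m<n⇒m<1+n x<s))))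
  ... | tri≈ _ x≡s _ = contradiction x≡s x≢s
  ... | tri> _ _ s<x = count-unchanged w ≤[ x ] (𝟙-yes (s ≤? x) (<⇒≤ s<x)) (𝟙-yes (suc s ≤? x) s<x)
                         (𝟙-yes (suc (suc s) ≤? x) (≤∧≢⇒< s<x (x≢1+s ∘ sym)))

  count-≥[]-far : ∀ w z → z ≢ suc s → z ≢ suc (suc s) → count C′ w ≥[ z ] ≡ count C w ≥[ z ]
  count-≥[]-far w z z≢1+s z≢2+s with <-cmp z (suc s)
  ... | tri< z<1+s _ _ = count-unchanged w ≥[ z ] (𝟙-yes (z ≤? s) (≤-pred z<1+s)) (𝟙-yes (z ≤? suc s) (<⇒≤ z<1+s))
                           (𝟙-yes (z ≤? suc (suc s)) (m≤n⇒m≤1+n (<⇒≤ z<1+s)))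
  ... | tri≈ _ z≡1+s _ = contradiction z≡1+s z≢1+s
  ... | tri> _ _ 1+s<z = count-unchanged w ≥[ z ] (𝟙-no (z ≤? s) (<⇒≱ (<-trans (n<1+n s) 1+s<z)))
                           (𝟙-no (z ≤? suc s) (<⇒≱ 1+s<z))
                           (𝟙-no (z ≤? suc (suc s)) (<⇒≱ (≤∧≢⇒< 1+s<z (z≢2+s ∘ sym))))

  pair≤count-at : ∀ w → w α + w β ≤ count C w ≡[ suc s ]
  pair≤count-at w = subst (_≤ count C w ≡[ suc s ]) (cong₂ _+_ (at α Cα) (at β Cβ)) (pair≤sum _ α≢β)
    where
    at : ∀ γ → lookup C γ ≡ suc s → w γ * ≡[ suc s ] (lookup C γ) ≡ w γ
    at γ Cγ = trans (cong (λ v → w γ * ≡[ suc s ] v) Cγ)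
                    (trans (cong (w γ *_) (𝟙-yes (suc s ≟ suc s) refl)) (*-identityʳ (w γ)))

  -- Split the two chips into the parts weighted by w and by 1 ∸ w: both lower bounds are attained.
  count-at≡pair : count C every ≡[ suc s ] ≡ 2 → ∀ w → (∀ γ → w γ ≤ 1) → count C w ≡[ suc s ] ≡ w α + w β
  count-at≡pair two w w≤1 = ≤-antisym upper (pair≤count-at w)
    where
    w̄ : Fin n → ℕ
    w̄ γ = 1 ∸ w γ
    total : count C w ≡[ suc s ] + count C w̄ ≡[ suc s ] ≡ (w α + w β) + (w̄ α + w̄ β)
    total = begin
      count C w ≡[ suc s ] + count C w̄ ≡[ suc s ]  ≡⟨ ∑-distrib-+ (λ γ → w γ * site γ) (λ γ → w̄ γ * site γ) ⟨
      sum (λ γ → w γ * site γ + w̄ γ * site γ)     ≡⟨ sum-cong-≗ (λ γ → trans (sym (*-distribʳ-+ (site γ) (w γ) (w̄ γ)))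
                                                        (cong (_* site γ) (m+[n∸m]≡n (w≤1 γ)))) ⟩
      count C every ≡[ suc s ]                    ≡⟨ two ⟩
      2                                           ≡⟨ cong₂ _+_ (m+[n∸m]≡n (w≤1 α)) (m+[n∸m]≡n (w≤1 β)) ⟨
      (w α + w̄ α) + (w β + w̄ β)                  ≡⟨ interchange (w α) (w̄ α) (w β) (w̄ β) ⟩
      (w α + w β) + (w̄ α + w̄ β)                  ∎
      where
      open ≡-Reasoning
      site : Fin n → ℕ
      site γ = ≡[ suc s ] (lookup C γ)
    upper : count C w ≡[ suc s ] ≤ w α + w β
    upper = +-cancelʳ-≤ (count C w̄ ≡[ suc s ]) _ _
              (subst (_≤ (w α + w β) + count C w̄ ≡[ suc s ]) (sym total) (+-monoʳ-≤ (w α + w β) (pair≤count-at w̄)))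

-- The invariant

record Balanced {n} (h : ℕ) (C : Config n) : Set where
  field
    chipsUpTo≤ : ∀ x → chipsUpTo C x ≤ suc x
    ≤chipsUpTo : ∀ x → x ≤ n → x ≤ chipsUpTo C x
    high≤tight : ∀ x → highUpTo h C x ≤ tightBelow C x
    -- the number of loose y with z ≤ y < n bounds lowFrom h C z, stated without subtraction
    low≤loose : ∀ z → z ≤ n → lowFrom h C z + tightBelow C n ≤ (n ∸ z) + tightBelow C z

  site≤n : ∀ γ → lookup C γ ≤ n
  site≤n γ = 𝟙-pos (lookup C γ ≤? n) (≤-reflexive (sym (trans (sym (+-identityʳ _))
    (sum-full (λ γ → subst (_≤ 1) (sym (+-identityʳ _)) (𝟙≤1 _)) (≤chipsUpTo n ≤-refl) γ))))

high-ordered : ∀ {n} h {α β : Fin n} → α Fin.< β → high h α ≡ 1 → high h β ≡ 1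
high-ordered h {α} {β} α<β α-high =
  𝟙-yes (h ≤? toℕ β) (≤-trans (𝟙-pos (h ≤? toℕ α) (≤-reflexive (sym α-high))) (<⇒≤ α<β))

low-ordered : ∀ {n} h {α β : Fin n} → α Fin.< β → low h β ≡ 1 → low h α ≡ 1
low-ordered h {α} {β} α<β β-low =
  𝟙-yes (toℕ α <? h) (<-trans α<β (𝟙-pos (toℕ β <? h) (≤-reflexive (sym β-low))))

module BalancedToppling {n} (h : ℕ) (C : Config n) (α β : Fin n) (s : ℕ) (α<β : α Fin.< β)
                       (Cα : lookup C α ≡ suc s) (Cβ : lookup C β ≡ suc s) (bal : Balanced h C) where
  open Toppling C α β s α<β Cα Cβ
  open Balanced bal

  1+s≤n : suc s ≤ n
  1+s≤n = subst (_≤ n) Cα (site≤n α)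

  -- s ≤ chipsUpTo C s and chipsUpTo C (suc s) ≤ suc (suc s) leave room for exactly two chips on suc s.
  chips-s×two-at-1+s : chipsUpTo C s ≡ s × count C every ≡[ suc s ] ≡ 2
  chips-s×two-at-1+s = ≤-antisym Ns≤s (≤chipsUpTo s (≤-trans (n≤1+n s) 1+s≤n)) , ≤-antisym two≥ (pair≤count-at every)
    where
    bound : chipsUpTo C s + count C every ≡[ suc s ] ≤ s + 2
    bound = subst₂ _≤_ (count-≤[]-split C every s) (+-comm 2 s) (chipsUpTo≤ (suc s))
    Ns≤s : chipsUpTo C s ≤ s
    Ns≤s = +-cancelʳ-≤ 2 _ s (≤-trans (+-monoʳ-≤ (chipsUpTo C s) (pair≤count-at every)) bound)
    two≥ : count C every ≡[ suc s ] ≤ 2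
    two≥ = +-cancelˡ-≤ s _ 2 (≤-trans (+-monoˡ-≤ _ (≤chipsUpTo s (≤-trans (n≤1+n s) 1+s≤n))) bound)

  chips-s : chipsUpTo C s ≡ s
  chips-s = proj₁ chips-s×two-at-1+s

  chips-1+s : chipsUpTo C (suc s) ≡ suc (suc s)
  chips-1+s = trans (count-≤[]-split C every s) (trans (cong₂ _+_ chips-s (proj₂ chips-s×two-at-1+s)) (+-comm s 2))

  2+s≤n : suc (suc s) ≤ n
  2+s≤n = subst (_≤ n) chips-1+s (count≤length C ≤[ suc s ] (λ _ → ≤-refl) (λ _ → 𝟙≤1 _))

  chips′-s : chipsUpTo C′ s ≡ suc s
  chips′-s = trans (count-≤[s] every) (trans (cong (_+ 1) chips-s) (+-comm s 1))

  chips′-1+s : chipsUpTo C′ (suc s) ≡ suc s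
  chips′-1+s = +-cancelʳ-≡ 1 _ _ (trans (count-≤[1+s] every) (trans chips-1+s (+-comm 1 (suc s))))

  tight′-far : ∀ x → x ≢ suc s → tightBelow C′ x ≡ tightBelow C x
  tight′-far = ∑<-swap s (λ y y≢s y≢1+s → cong (λ N → 𝟙 (N ≟ y)) (count-≤[]-far every y y≢s y≢1+s)) (begin
    tight? C′ s + tight? C′ (suc s)  ≡⟨ cong₂ _+_ (𝟙-no (_ ≟ s) (1+n≢n ∘ trans (sym chips′-s)))
                                                  (𝟙-yes (_ ≟ suc s) chips′-1+s) ⟩
    1                                ≡⟨ cong₂ _+_ (𝟙-yes (_ ≟ s) chips-s)
                                                  (𝟙-no (_ ≟ suc s) (1+n≢n ∘ trans (sym chips-1+s))) ⟨
    tight? C s + tight? C (suc s)    ∎)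
    where open ≡-Reasoning

  tight′-1+s : tightBelow C′ (suc s) ≡ tightBelow C s
  tight′-1+s = trans (cong₂ _+_ (tight′-far s (1+n≢n ∘ sym)) (𝟙-no (_ ≟ s) (1+n≢n ∘ trans (sym chips′-s)))) (+-identityʳ _)

  tight-1+s : tightBelow C (suc s) ≡ suc (tightBelow C s)
  tight-1+s = trans (cong (tightBelow C s +_) (𝟙-yes (_ ≟ s) chips-s)) (+-comm _ 1)

  tight-2+s : tightBelow C (suc (suc s)) ≡ suc (tightBelow C s)
  tight-2+s = trans (cong₂ _+_ tight-1+s (𝟙-no (_ ≟ suc s) (1+n≢n ∘ trans (sym chips-1+s)))) (+-identityʳ _)

  high-1+s : highUpTo h C (suc s) ≡ highUpTo h C s + (high h α + high h β)
  high-1+s = trans (count-≤[]-split C (high h) s)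
                (cong (highUpTo h C s +_) (count-at≡pair (proj₂ chips-s×two-at-1+s) (high h) (λ _ → 𝟙≤1 _)))

  high-absorbed : highUpTo h C s + high h α ≤ tightBelow C s
  high-absorbed = ordered-bit-absorbed (𝟙≤1 _) (high-ordered h α<β) (high≤tight s)
                    (subst₂ _≤_ high-1+s tight-1+s (high≤tight (suc s)))

  high′-1+s : highUpTo h C′ (suc s) ≡ highUpTo h C s + high h α
  high′-1+s = +-cancelʳ-≡ (high h β) _ _
    (trans (count-≤[1+s] (high h)) (trans high-1+s (sym (+-assoc (highUpTo h C s) _ _))))

  low-1+s : lowFrom h C (suc s) ≡ (low h α + low h β) + lowFrom h C (suc (suc s))
  low-1+s = trans (count-≥[]-split C (low h) (suc s))
                (cong (_+ lowFrom h C (suc (suc s))) (count-at≡pair (proj₂ chips-s×two-at-1+s) (low h) (λ _ → 𝟙≤1 _)))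

  low′-1+s : lowFrom h C′ (suc s) ≡ low h β + lowFrom h C (suc (suc s))
  low′-1+s = +-cancelʳ-≡ (low h α) _ _ (trans (count-≥[1+s] (low h)) (trans low-1+s (reorder (low h α) (low h β) _)))
    where
    reorder : ∀ a b L → (a + b) + L ≡ (b + L) + a
    reorder = solve-∀

  n∸[1+s] : n ∸ suc s ≡ suc (n ∸ suc (suc s))
  n∸[1+s] = +-∸-assoc 1 2+s≤n

  low-absorbed : lowFrom h C (suc (suc s)) + tightBelow C n + low h β ≤ (n ∸ suc (suc s)) + suc (tightBelow C s)
  low-absorbed = ordered-bit-absorbed (𝟙≤1 _) (low-ordered h α<β)
    (subst (λ k → lowFrom h C (suc (suc s)) + tightBelow C n ≤ (n ∸ suc (suc s)) + k) tight-2+s (low≤loose (suc (suc s)) 2+s≤n))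
    (subst₂ _≤_ (trans (cong (_+ tightBelow C n) low-1+s) (reorder (low h α) (low h β) _ _))
                (cong₂ _+_ n∸[1+s] tight-1+s)
                (low≤loose (suc s) 1+s≤n))
    where
    reorder : ∀ a b L K → (a + b) + L + K ≡ L + K + (b + a)
    reorder = solve-∀

  n≢1+s : n ≢ suc s
  n≢1+s n≡1+s = 1+n≰n (subst (suc (suc s) ≤_) n≡1+s 2+s≤n)

  preserved : Balanced h C′
  preserved = record
    { chipsUpTo≤ = chipsUpTo≤′
    ; ≤chipsUpTo = ≤chipsUpTo′
    ; high≤tight = high≤tight′
    ; low≤loose = low≤loose′
    }
    where
    chipsUpTo≤′ : ∀ x → chipsUpTo C′ x ≤ suc x
    chipsUpTo≤′ x with x ≟ s | x ≟ suc s
    ... | yes refl | _ = ≤-reflexive chips′-s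
    ... | no _ | yes refl = ≤-trans (≤-reflexive chips′-1+s) (n≤1+n _)
    ... | no x≢s | no x≢1+s = subst (_≤ suc x) (sym (count-≤[]-far every x x≢s x≢1+s)) (chipsUpTo≤ x)

    ≤chipsUpTo′ : ∀ x → x ≤ n → x ≤ chipsUpTo C′ x
    ≤chipsUpTo′ x x≤n with x ≟ s | x ≟ suc s
    ... | yes refl | _ = ≤-trans (n≤1+n x) (≤-reflexive (sym chips′-s))
    ... | no _ | yes refl = ≤-reflexive (sym chips′-1+s)
    ... | no x≢s | no x≢1+s = subst (x ≤_) (sym (count-≤[]-far every x x≢s x≢1+s)) (≤chipsUpTo x x≤n)

    high≤tight′ : ∀ x → highUpTo h C′ x ≤ tightBelow C′ x
    high≤tight′ x with x ≟ s | x ≟ suc s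
    ... | yes refl | _ = subst₂ _≤_ (sym (count-≤[s] (high h))) (sym (tight′-far s (1+n≢n ∘ sym))) high-absorbed
    ... | no _ | yes refl = subst₂ _≤_ (sym high′-1+s) (sym tight′-1+s) high-absorbed
    ... | no x≢s | no x≢1+s =
      subst₂ _≤_ (sym (count-≤[]-far (high h) x x≢s x≢1+s)) (sym (tight′-far x x≢1+s)) (high≤tight x)

    low≤loose′ : ∀ z → z ≤ n → lowFrom h C′ z + tightBelow C′ n ≤ (n ∸ z) + tightBelow C′ z
    low≤loose′ z z≤bound with z ≟ suc s | z ≟ suc (suc s)
    ... | yes refl | _ =
      subst₂ _≤_ (trans (reorder (lowFrom h C (suc (suc s))) (tightBelow C n) (low h β))
                        (sym (cong₂ _+_ low′-1+s (tight′-far n n≢1+s))))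
                 (trans (+-suc (n ∸ suc (suc s)) (tightBelow C s)) (sym (cong₂ _+_ n∸[1+s] tight′-1+s)))
                 low-absorbed
      where
      reorder : ∀ L K b → L + K + b ≡ (b + L) + K
      reorder = solve-∀
    ... | no _ | yes refl =
      subst₂ _≤_ (trans (reorder (lowFrom h C (suc (suc s))) (tightBelow C n) (low h β))
                        (sym (cong₂ _+_ (count-≥[2+s] (low h)) (tight′-far n n≢1+s))))
                 (cong ((n ∸ suc (suc s)) +_) (trans (sym tight-2+s) (sym (tight′-far (suc (suc s)) 1+n≢n))))
                 low-absorbed
      where
      reorder : ∀ L K b → L + K + b ≡ (L + b) + K
      reorder = solve-∀
    ... | no z≢1+s | no z≢2+s =
      subst₂ _≤_ (sym (cong₂ _+_ (count-≥[]-far (low h) z z≢1+s z≢2+s) (tight′-far n n≢1+s)))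
                 (sym (cong ((n ∸ z) +_) (tight′-far z z≢1+s)))
                 (low≤loose z z≤bound)

balanced-topples : ∀ {n} h {C D : Config n} → Topples* C D → Balanced h C → Balanced h D
balanced-topples h ε bal = bal
balanced-topples h (topple C α β s α<β Cα Cβ ◅ steps) bal =
  balanced-topples h steps (BalancedToppling.preserved h C α β s α<β Cα Cβ bal)

module InitialConfig (m p : ℕ) (p≤m : p ≤ m) (C : Config (suc m)) (C∈𝒮 : InS (suc m) p C) where

  n h : ℕ
  n = suc m
  h = n ∸ p

  count-initial : ∀ q → count C every q ≡ q p + ∑< m (q ∘ suc)
  count-initial q = begin
    count C every q                                ≡⟨ count-every-toList C q ⟩
    listSum (List.map q (toList C))                ≡⟨ sum-↭ (map⁺ q C∈𝒮) ⟩
    q p + listSum (List.map q (List.map suc (List.upTo m)))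
      ≡⟨ cong (λ xs → q p + listSum (List.map q xs)) (List.map-upTo suc m) ⟩
    q p + listSum (List.map q (applyUpTo suc m))   ≡⟨ cong (λ xs → q p + listSum xs) (List.map-applyUpTo suc q m) ⟩
    q p + listSum (applyUpTo (q ∘ suc) m)          ≡⟨ cong (q p +_) (listSum-applyUpTo (q ∘ suc) m) ⟩
    q p + ∑< m (q ∘ suc)                           ∎
    where open ≡-Reasoning

  chips-initial : ∀ x → chipsUpTo C x ≡ ≤[ x ] p + x ⊓ m
  chips-initial x = trans (count-initial ≤[ x ]) (cong (≤[ x ] p +_) (∑<-below x m))

  chips-below-p : ∀ y → y < p → chipsUpTo C y ≡ y
  chips-below-p y y<p = trans (chips-initial y)
    (cong₂ _+_ (𝟙-no (p ≤? y) (<⇒≱ y<p)) (m≤n⇒m⊓n≡m (≤-trans (<⇒≤ y<p) p≤m)))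

  chips-from-p : ∀ y → p ≤ y → y ≤ m → chipsUpTo C y ≡ suc y
  chips-from-p y p≤y y≤m = trans (chips-initial y) (cong₂ _+_ (𝟙-yes (p ≤? y) p≤y) (m≤n⇒m⊓n≡m y≤m))

  tightBelow-initial : ∀ x → x ≤ n → tightBelow C x ≡ p ⊓ x
  tightBelow-initial x x≤n = trans (∑<-cong x tight⇔below) (∑<-below p x)
    where
    tight⇔below : ∀ y → y < x → tight? C y ≡ 𝟙 (y <? p)
    tight⇔below y y<x with y <? p
    ... | yes y<p = 𝟙-yes (_ ≟ y) (chips-below-p y y<p)
    ... | no y≮p = 𝟙-no (_ ≟ y) (1+n≢n ∘ trans (sym (chips-from-p y (≮⇒≥ y≮p) (≤-pred (≤-trans y<x x≤n)))))

  tightBelow-n : tightBelow C n ≡ p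
  tightBelow-n = trans (tightBelow-initial n ≤-refl) (m≤n⇒m⊓n≡m (m≤n⇒m≤1+n p≤m))

  #high : sum {n} (high h) ≡ p
  #high = trans (sum-toℕ n (λ y → 𝟙 (h ≤? y))) (trans (∑<-atLeast h n) (m∸[m∸n]≡n (m≤n⇒m≤1+n p≤m)))

  #low : sum {n} (low h) ≡ h
  #low = trans (sum-toℕ n (λ y → 𝟙 (y <? h))) (trans (∑<-below h n) (m≤n⇒m⊓n≡m (m∸n≤m n p)))

  balanced : Balanced h C
  balanced = record
    { chipsUpTo≤ = λ x → subst (_≤ suc x) (sym (chips-initial x)) (+-mono-≤ (𝟙≤1 _) (m⊓n≤m x m))
    ; ≤chipsUpTo = ≤chipsUpTo
    ; high≤tight = high≤tight
    ; low≤loose = low≤loose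
    }
    where
    ≤chipsUpTo : ∀ x → x ≤ n → x ≤ chipsUpTo C x
    ≤chipsUpTo x x≤n with x ≤? m
    ... | yes x≤m = subst (x ≤_) (sym (chips-initial x)) (≤-trans (≤-reflexive (sym (m≤n⇒m⊓n≡m x≤m))) (m≤n+m _ _))
    ... | no x≰m = subst (x ≤_) (sym (chips-initial x))
                     (subst₂ _≤_ n≡x (sym (cong₂ _+_ (𝟙-yes (p ≤? x) (≤-trans p≤m m≤x)) (m≥n⇒m⊓n≡n m≤x))) ≤-refl)
      where
      m≤x : m ≤ x
      m≤x = <⇒≤ (≰⇒> x≰m)
      n≡x : n ≡ x
      n≡x = ≤-antisym (≰⇒> x≰m) x≤n

    high≤tight : ∀ x → highUpTo h C x ≤ tightBelow C x
    high≤tight x with x <? p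
    ... | yes x<p = begin
      highUpTo h C x    ≤⟨ count-mono C {high h} {every} ≤[ x ] (λ _ → 𝟙≤1 _) ⟩
      chipsUpTo C x     ≡⟨ chips-below-p x x<p ⟩
      x                 ≡⟨ m≥n⇒m⊓n≡n (<⇒≤ x<p) ⟨
      p ⊓ x             ≡⟨ tightBelow-initial x (≤-trans (<⇒≤ x<p) (m≤n⇒m≤1+n p≤m)) ⟨
      tightBelow C x    ∎
      where open ≤-Reasoning
    ... | no x≮p = begin
      highUpTo h C x    ≤⟨ count≤weights C (high h) ≤[ x ] (λ _ → 𝟙≤1 _) ⟩
      sum {n} (high h)  ≡⟨ #high ⟩
      p                 ≡⟨ ⊓-idem p ⟨
      p ⊓ p             ≡⟨ tightBelow-initial p (m≤n⇒m≤1+n p≤m) ⟨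
      tightBelow C p    ≤⟨ ∑<-mono _ (≮⇒≥ x≮p) ⟩
      tightBelow C x    ∎
      where open ≤-Reasoning

    low≤loose : ∀ z → z ≤ n → lowFrom h C z + tightBelow C n ≤ (n ∸ z) + tightBelow C z
    low≤loose z z≤bound with z ≤? p
    ... | yes z≤p = begin
      lowFrom h C z + tightBelow C n  ≤⟨ +-monoˡ-≤ _ (count≤weights C (low h) ≥[ z ] (λ _ → 𝟙≤1 _)) ⟩
      sum {n} (low h) + tightBelow C n ≡⟨ cong₂ _+_ #low tightBelow-n ⟩
      h + p                           ≡⟨ m∸n+n≡m (m≤n⇒m≤1+n p≤m) ⟩
      n                               ≡⟨ m∸n+n≡m z≤bound ⟨
      (n ∸ z) + z                     ≡⟨ cong ((n ∸ z) +_)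
                                           (trans (sym (m≥n⇒m⊓n≡n z≤p)) (sym (tightBelow-initial z z≤bound))) ⟩
      (n ∸ z) + tightBelow C z        ∎
      where open ≤-Reasoning
    low≤loose zero _ | no 0≰p = contradiction z≤n 0≰p
    low≤loose (suc z) 1+z≤n | no 1+z≰p = begin
      lowFrom h C (suc z) + tightBelow C n  ≤⟨ +-monoˡ-≤ _
                                                (≤-trans (count-mono C {low h} {every} ≥[ suc z ] (λ _ → 𝟙≤1 _)) chips-right) ⟩
      (n ∸ suc z) + tightBelow C n          ≡⟨ cong ((n ∸ suc z) +_) (trans tightBelow-n (sym tightBelow-1+z)) ⟩
      (n ∸ suc z) + tightBelow C (suc z)    ∎
      where
      open ≤-Reasoning
      p≤z : p ≤ z
      p≤z = ≤-pred (≰⇒> 1+z≰p)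
      tightBelow-1+z : tightBelow C (suc z) ≡ p
      tightBelow-1+z = trans (tightBelow-initial (suc z) 1+z≤n) (m≤n⇒m⊓n≡m (m≤n⇒m≤1+n p≤z))
      chips-right : count C every ≥[ suc z ] ≤ n ∸ suc z
      chips-right = m+n≤o⇒m≤o∸n (count C every ≥[ suc z ]) (begin
        count C every ≥[ suc z ] + suc z             ≡⟨ cong (count C every ≥[ suc z ] +_) (chips-from-p z p≤z (≤-pred 1+z≤n)) ⟨
        count C every ≥[ suc z ] + chipsUpTo C z     ≡⟨ count-+ C every ≥[ suc z ] ≤[ z ] ⟨
        count C every (λ v → ≥[ suc z ] v + ≤[ z ] v)
          ≤⟨ count≤length C _ (λ _ → ≤-refl) (λ v → ≤-reflexive (≥[1+z]+≤[z]≡1 z v)) ⟩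
        n                                            ∎)

-- Stable configurations

module StableBalanced {n} (h : ℕ) (D : Config n) (bal : Balanced h D) (stable : Stable D) where
  open Balanced bal

  site-count≤1 : ∀ v → count D every ≡[ v ] ≤ 1
  site-count≤1 v = sum≤1 (λ γ → subst (_≤ 1) (sym (+-identityʳ _)) (𝟙≤1 _))
                         (λ γ δ γ-at-v δ-at-v → stable γ δ (trans (at γ γ-at-v) (sym (at δ δ-at-v))))
    where
    at : ∀ γ → 1 ≤ every γ * ≡[ v ] (lookup D γ) → lookup D γ ≡ v
    at γ 1≤ = 𝟙-pos (lookup D γ ≟ v) (subst (1 ≤_) (+-identityʳ _) 1≤)

  tight-propagates : ∀ y → chipsUpTo D y ≡ y → ∀ x → y ≤ x → x ≤ n → chipsUpTo D x ≡ x
  tight-propagates y tight x y≤x x≤n with m≤n⇒m<n∨m≡n y≤x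
  ... | inj₂ refl = tight
  tight-propagates y tight (suc x) _ 1+x≤n | inj₁ (s≤s y≤x) = ≤-antisym (begin
    chipsUpTo D (suc x)                          ≡⟨ count-≤[]-split D every x ⟩
    chipsUpTo D x + count D every ≡[ suc x ]     ≤⟨ +-monoʳ-≤ _ (site-count≤1 (suc x)) ⟩
    chipsUpTo D x + 1                            ≡⟨ cong (_+ 1) (tight-propagates y tight x y≤x (≤-trans (n≤1+n x) 1+x≤n)) ⟩
    x + 1                                        ≡⟨ +-comm x 1 ⟩
    suc x                                        ∎) (≤chipsUpTo (suc x) 1+x≤n)
    where open ≤-Reasoning

  high-before-low : ∀ γ δ → h ≤ toℕ γ → toℕ δ < h → ¬ lookup D γ < lookup D δ
  high-before-low γ δ γ-high δ-low Dγ<Dδ = contradiction (≤-trans low-δ low-none) (λ ())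
    where
    s z : ℕ
    s = lookup D γ
    z = suc s
    z≤n′ : z ≤ n
    z≤n′ = ≤-trans Dγ<Dδ (site≤n δ)
    both-set : ∀ {P Q : Set} (d : Dec P) (e : Dec Q) → P → Q → 1 ≤ 𝟙 d * 𝟙 e
    both-set d e p q = ≤-reflexive (sym (cong₂ _*_ (𝟙-yes d p) (𝟙-yes e q)))
    low-δ : 1 ≤ lowFrom h D z
    low-δ = ≤-trans (both-set (toℕ δ <? h) (z ≤? lookup D δ) δ-low Dγ<Dδ) (point≤sum _ δ)
    tight-below-s : ∃ λ y → y < s × 1 ≤ tight? D y
    tight-below-s = ∑<-witness s (tight? D)
      (≤-trans (≤-trans (both-set (h ≤? toℕ γ) (s ≤? s) γ-high ≤-refl) (point≤sum _ γ)) (high≤tight s))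
    tight-from-z : ∀ x → z ≤ x → x < n → tight? D x ≡ 1
    tight-from-z x z≤x x<n with y , y<s , y-tight ← tight-below-s =
      𝟙-yes (_ ≟ x) (tight-propagates y (𝟙-pos (_ ≟ y) y-tight) x
                       (≤-trans (<⇒≤ y<s) (≤-trans (n≤1+n s) z≤x)) (<⇒≤ x<n))
    tightBelow-n : tightBelow D n ≡ tightBelow D z + (n ∸ z)
    tightBelow-n = trans (cong (tightBelow D) (sym (m+[n∸m]≡n z≤n′)))
      (∑<-ones z (n ∸ z) λ x z≤x x<n → tight-from-z x z≤x (subst (x <_) (m+[n∸m]≡n z≤n′) x<n))
    low-none : lowFrom h D z ≤ 0
    low-none = +-cancelʳ-≤ (tightBelow D n) _ 0
      (subst (lowFrom h D z + tightBelow D n ≤_) (trans (+-comm (n ∸ z) _) (sym tightBelow-n)) (low≤loose z z≤n′))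

bounded-injection : ∀ {a b n} (f : Fin a → Fin n) → (∀ {i j} → f i ≡ f j → i ≡ j) → (∀ i → toℕ (f i) < b) → a ≤ b
bounded-injection f f-inj f<b = Finₚ.injective⇒≤ {f = λ i → fromℕ< (f<b i)} λ {i} {j} eq →
  f-inj (Finₚ.toℕ-injective (trans (sym (Finₚ.toℕ-fromℕ< (f<b i))) (trans (cong toℕ eq) (Finₚ.toℕ-fromℕ< (f<b j)))))

module _ {n} (π : Permutation′ n) {h : ℕ} (h≤n : h ≤ n) where

  lift : Fin h → Fin n
  lift i = inject≤ i h≤n

  lift-injective : ∀ {i j} → lift i ≡ lift j → i ≡ j
  lift-injective = Finₚ.inject≤-injective h≤n h≤n _ _

  toℕ-lift : ∀ i → toℕ (lift i) < h
  toℕ-lift i = subst (_< h) (sym (Finₚ.toℕ-inject≤ i h≤n)) (Finₚ.toℕ<n i)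

  -- The h positions of the low labels would fit below j < h.
  low-labels-first : (∀ j k → j Fin.< k → h ≤ toℕ (π ⟨$⟩ʳ j) → ¬ toℕ (π ⟨$⟩ʳ k) < h) →
                     ∀ j → toℕ j < h → toℕ (π ⟨$⟩ʳ j) < h
  low-labels-first high-then-high j j<h with toℕ (π ⟨$⟩ʳ j) <? h
  ... | yes πj<h = πj<h
  ... | no πj≮h = contradiction (bounded-injection position position-injective position<j) (<⇒≱ j<h)
    where
    position : Fin h → Fin n
    position ℓ = π ⟨$⟩ˡ lift ℓ
    position-injective : ∀ {ℓ ℓ′} → position ℓ ≡ position ℓ′ → ℓ ≡ ℓ′
    position-injective = lift-injective ∘ Injection.injective (↔⇒↣ (Perm.flip π))
    position<j : ∀ ℓ → toℕ (position ℓ) < toℕ j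
    position<j ℓ with <-cmp (toℕ (position ℓ)) (toℕ j)
    ... | tri< k<j _ _ = k<j
    ... | tri≈ _ k≡j _ = contradiction (subst (λ k → toℕ (π ⟨$⟩ʳ k) < h) (Finₚ.toℕ-injective k≡j)
                           (subst (λ l → toℕ l < h) (sym (inverseʳ π)) (toℕ-lift ℓ))) πj≮h
    ... | tri> _ _ j<k = contradiction (subst (λ l → toℕ l < h) (sym (inverseʳ π)) (toℕ-lift ℓ))
                           (high-then-high j (position ℓ) j<k (≮⇒≥ πj≮h))

  -- A position outside the prefix with a low label would give h + 1 positions with low labels.
  prefix-onto : (∀ j → toℕ j < h → toℕ (π ⟨$⟩ʳ j) < h) → ∀ ℓ → toℕ ℓ < h → toℕ (π ⟨$⟩ˡ ℓ) < h
  prefix-onto prefix ℓ ℓ<h with toℕ (π ⟨$⟩ˡ ℓ) <? h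
  ... | yes k<h = k<h
  ... | no k≮h = contradiction
    (bounded-injection (λ i → π ⟨$⟩ʳ position i) (position-injective ∘ Injection.injective (↔⇒↣ π)) label<h) 1+n≰n
    where
    position : Fin (suc h) → Fin n
    position zero = π ⟨$⟩ˡ ℓ
    position (suc i) = lift i
    position-injective : ∀ {i i′} → position i ≡ position i′ → i ≡ i′
    position-injective {zero} {zero} _ = refl
    position-injective {zero} {suc i} eq = contradiction (subst (λ k → toℕ k < h) (sym eq) (toℕ-lift i)) k≮h
    position-injective {suc i} {zero} eq = contradiction (subst (λ k → toℕ k < h) eq (toℕ-lift i)) k≮h
    position-injective {suc i} {suc i′} eq = cong suc (lift-injective eq)
    label<h : ∀ i → toℕ (π ⟨$⟩ʳ position i) < h
    label<h zero = subst (λ l → toℕ l < h) (sym (inverseʳ π)) ℓ<h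
    label<h (suc i) = prefix (lift i) (toℕ-lift i)

-- The firing schedule

-- site c i j is the site, in stage c after i topplings, of the chip read at final position j:
-- in stage c the high chip read at h + c passes the low chips one by one, stage p - 1 first.
module FiringSchedule (n h p₁ : ℕ) (h+p≡n : h + suc p₁ ≡ n) (π : Permutation′ n)
                    (low-prefix : ∀ j → toℕ j < h → toℕ (π ⟨$⟩ʳ j) < h)
                    (high-suffix : ∀ j → h ≤ toℕ j → h ≤ toℕ (π ⟨$⟩ʳ j)) where

  p : ℕ
  p = suc p₁

  h≤n : h ≤ n
  h≤n = subst (h ≤_) h+p≡n (m≤m+n h p)

  lowSite highSite site : ℕ → ℕ → ℕ → ℕ
  lowSite c i j = c + j + 𝟙 (i ≤? j)
  highSite c i k = if? (k <? c) then suc k else (if? (k ≟ c) then suc (c + i) else suc (h + k))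
  site c i j = if? (j <? h) then lowSite c i j else highSite c i (j ∸ h)

  site-low : ∀ c i {j} → j < h → site c i j ≡ lowSite c i j
  site-low c i {j} j<h = if?-yes (j <? h) j<h

  site-high : ∀ c i k → site c i (h + k) ≡ highSite c i k
  site-high c i k = trans (if?-no (h + k <? h) (λ h+k<h → <⇒≱ h+k<h (m≤m+n h k)))
                          (cong (highSite c i) (m+n∸m≡n h k))

  State : ℕ → ℕ → Config n
  State c i = Vec.tabulate λ γ → site c i (toℕ (π ⟨$⟩ˡ γ))

  lookup-State : ∀ c i j → lookup (State c i) (π ⟨$⟩ʳ j) ≡ site c i (toℕ j)
  lookup-State c i j = trans (lookup∘tabulate (λ γ → site c i (toℕ (π ⟨$⟩ˡ γ))) (π ⟨$⟩ʳ j))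
                             (cong (site c i ∘ toℕ) (inverseˡ π))

  site-low-before : ∀ c i → i < h → site c i i ≡ suc (c + i)
  site-low-before c i i<h = trans (site-low c i i<h) (trans (cong (c + i +_) (𝟙-yes (i ≤? i) ≤-refl)) (+-comm (c + i) 1))

  site-low-after : ∀ c i → i < h → site c (suc i) i ≡ c + i
  site-low-after c i i<h = trans (site-low c (suc i) i<h) (trans (cong (c + i +_) (𝟙-no (suc i ≤? i) (n≮n i))) (+-identityʳ _))

  site-high-moving : ∀ c i → site c i (h + c) ≡ suc (c + i)
  site-high-moving c i = trans (site-high c i c) (trans (if?-no (c <? c) (n≮n c)) (if?-yes (c ≟ c) refl))

  site-others : ∀ c i j → j ≢ i → j ≢ h + c → site c i j ≡ site c (suc i) j
  site-others c i j j≢i j≢h+c with j <? h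
  ... | yes _ = cong (c + j +_) passed
    where
    passed : 𝟙 (i ≤? j) ≡ 𝟙 (suc i ≤? j)
    passed with i ≤? j | suc i ≤? j
    ... | yes _ | yes _ = refl
    ... | yes i≤j | no i≮j = contradiction (≤∧≢⇒< i≤j (j≢i ∘ sym)) i≮j
    ... | no i≰j | yes i<j = contradiction (<⇒≤ i<j) i≰j
    ... | no _ | no _ = refl
  ... | no j≮h = cong (if? (j ∸ h <? c) then suc (j ∸ h) else_)
                      (trans (if?-no (j ∸ h ≟ c) not-moving) (sym (if?-no (j ∸ h ≟ c) not-moving)))
    where
    not-moving : j ∸ h ≢ c
    not-moving eq = j≢h+c (trans (sym (m+[n∸m]≡n (≮⇒≥ j≮h))) (cong (h +_) eq))

  State-≡ : ∀ (V : Config n) c i → (∀ j → lookup V (π ⟨$⟩ʳ j) ≡ site c i (toℕ j)) → V ≡ State c i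
  State-≡ V c i V≗site = trans (sym (tabulate∘lookup V)) (tabulate-cong λ γ →
    trans (cong (lookup V) (sym (inverseʳ π))) (V≗site (π ⟨$⟩ˡ γ)))

  topple-step : ∀ c i → c < p → i < h → Topple (State c i) (State c (suc i))
  topple-step c i c<p i<h = subst (Topple (State c i)) (State-≡ _ c (suc i) after)
    (topple (State c i) α β (c + i) α<β (at jα (toℕ-jα) (site-low-before c i i<h)) (at jβ toℕ-jβ (site-high-moving c i)))
    where
    i<n : i < n
    i<n = <-≤-trans i<h h≤n
    h+c<n : h + c < n
    h+c<n = subst (h + c <_) h+p≡n (+-monoʳ-< h c<p)
    jα jβ : Fin n
    jα = fromℕ< i<n
    jβ = fromℕ< h+c<n
    toℕ-jα : toℕ jα ≡ i
    toℕ-jα = Finₚ.toℕ-fromℕ< i<n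
    toℕ-jβ : toℕ jβ ≡ h + c
    toℕ-jβ = Finₚ.toℕ-fromℕ< h+c<n
    α β : Fin n
    α = π ⟨$⟩ʳ jα
    β = π ⟨$⟩ʳ jβ
    α<β : α Fin.< β
    α<β = <-≤-trans (low-prefix jα (subst (_< h) (sym toℕ-jα) i<h)) (high-suffix jβ (subst (h ≤_) (sym toℕ-jβ) (m≤m+n h c)))
    at : ∀ j {x v} → toℕ j ≡ x → site c i x ≡ v → lookup (State c i) (π ⟨$⟩ʳ j) ≡ v
    at j refl eq = trans (lookup-State c i j) eq
    S₁ : Config n
    S₁ = State c i [ α ]≔ (c + i)
    after : ∀ j → lookup (S₁ [ β ]≔ suc (suc (c + i))) (π ⟨$⟩ʳ j) ≡ site c (suc i) (toℕ j)
    after j with j Fin.≟ jβ | j Fin.≟ jα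
    ... | yes refl | _ = trans (lookup∘update β S₁ _)
                               (sym (trans (cong (site c (suc i)) toℕ-jβ) (trans (site-high-moving c (suc i)) (cong suc (+-suc c i)))))
    ... | no j≢jβ | yes refl = trans (lookup∘update′ (j≢jβ ∘ Injection.injective (↔⇒↣ π)) S₁ _)
                                 (trans (lookup∘update α (State c i) _)
                                        (sym (trans (cong (site c (suc i)) toℕ-jα) (site-low-after c i i<h))))
    ... | no j≢jβ | no j≢jα = trans (lookup∘update′ (j≢jβ ∘ Injection.injective (↔⇒↣ π)) S₁ _)
                                (trans (lookup∘update′ (j≢jα ∘ Injection.injective (↔⇒↣ π)) (State c i) _)
                                  (trans (lookup-State c i j)
                                    (site-others c i (toℕ j) (j≢jα ∘ Finₚ.toℕ-injective ∘ (λ e → trans e (sym toℕ-jα)))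
                                                             (j≢jβ ∘ Finₚ.toℕ-injective ∘ (λ e → trans e (sym toℕ-jβ))))))

  pass-lows : ∀ c → c < p → ∀ i d → i + d ≡ h → Topples* (State c i) (State c h)
  pass-lows c c<p i zero i≡h = subst (λ x → Topples* (State c i) (State c x)) (trans (sym (+-identityʳ i)) i≡h) ε
  pass-lows c c<p i (suc d) i+1+d≡h = topple-step c i c<p i<h ◅ pass-lows c c<p (suc i) d (trans (sym (+-suc i d)) i+1+d≡h)
    where
    i<h : i < h
    i<h = subst (i <_) i+1+d≡h (m<m+n i (s≤s z≤n))

  next-stage : ∀ c → State (suc c) h ≡ State c 0
  next-stage c = tabulate-cong λ γ → same-site (toℕ (π ⟨$⟩ˡ γ))
    where
    same-site : ∀ j → site (suc c) h j ≡ site c 0 j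
    same-site j with j <? h
    ... | yes j<h = trans (cong (suc c + j +_) (𝟙-no (h ≤? j) (<⇒≱ j<h))) (trans (+-identityʳ _) (sym (+-comm (c + j) 1)))
    ... | no _ with <-cmp (j ∸ h) c
    ...   | tri< k<c _ _ = trans (if?-yes (_ <? suc c) (m<n⇒m<1+n k<c)) (sym (if?-yes (_ <? c) k<c))
    ...   | tri≈ _ k≡c _ = trans (if?-yes (_ <? suc c) (s≤s (≤-reflexive k≡c)))
                             (sym (trans (if?-no (_ <? c) (<-irrefl k≡c))
                                  (trans (if?-yes (_ ≟ c) k≡c) (cong suc (trans (+-identityʳ c) (sym k≡c))))))
    ...   | tri> _ _ c<k with j ∸ h ≟ suc c
    ...     | yes k≡1+c = trans (if?-no (_ <? suc c) (<⇒≱ c<k ∘ ≤-pred))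
                              (sym (trans (if?-no (_ <? c) (<⇒≱ c<k ∘ <⇒≤)) (trans (if?-no (_ ≟ c) (>⇒≢ c<k))
                                (cong suc (trans (cong (h +_) k≡1+c) (+-comm h (suc c)))))))
    ...     | no _ = trans (if?-no (_ <? suc c) (<⇒≱ c<k ∘ ≤-pred))
                             (sym (trans (if?-no (_ <? c) (<⇒≱ c<k ∘ <⇒≤)) (if?-no (_ ≟ c) (>⇒≢ c<k))))

  all-stages : ∀ c → c < p → Topples* (State c 0) (State 0 h)
  all-stages zero 0<p = pass-lows 0 0<p 0 h refl
  all-stages (suc c) 1+c<p = pass-lows (suc c) 1+c<p 0 h refl
    ◅◅ subst (λ S → Topples* S (State 0 h)) (sym (next-stage c)) (all-stages c (<-trans (n<1+n c) 1+c<p))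

  final-site : ∀ j → site 0 h j ≡ j + 𝟙 (h ≤? j)
  final-site j with j <? h
  ... | yes _ = refl
  ... | no j≮h = trans (moved (j ∸ h ≟ 0)) (trans (cong suc (m+[n∸m]≡n (≮⇒≥ j≮h)))
                   (trans (+-comm 1 j) (cong (j +_) (sym (𝟙-yes (h ≤? j) (≮⇒≥ j≮h))))))
    where
    moved : (d : Dec (j ∸ h ≡ 0)) → (if? d then suc h else suc (h + (j ∸ h))) ≡ suc (h + (j ∸ h))
    moved (yes k≡0) = cong suc (trans (sym (+-identityʳ h)) (cong (h +_) (sym k≡0)))
    moved (no _) = refl

  final-site-< : ∀ {j k} → j < k → j + 𝟙 (h ≤? j) < k + 𝟙 (h ≤? k)
  final-site-< {j} {k} j<k with h ≤? j | h ≤? k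
  ... | yes h≤j | no h≰k = contradiction (≤-trans h≤j (<⇒≤ j<k)) h≰k
  ... | yes _ | yes _ = +-monoˡ-< 1 j<k
  ... | no _ | yes _ = +-mono-<-≤ j<k z≤n
  ... | no _ | no _ = +-monoˡ-< 0 j<k

  final-stable : Stable (State 0 h)
  final-stable γ δ same = trans (sym (inverseʳ π)) (trans (cong (π ⟨$⟩ʳ_) (Finₚ.toℕ-injective positions)) (inverseʳ π))
    where
    sites : ∀ γ → lookup (State 0 h) γ ≡ toℕ (π ⟨$⟩ˡ γ) + 𝟙 (h ≤? toℕ (π ⟨$⟩ˡ γ))
    sites γ = trans (lookup∘tabulate _ γ) (final-site _)
    positions : toℕ (π ⟨$⟩ˡ γ) ≡ toℕ (π ⟨$⟩ˡ δ)
    positions with <-cmp (toℕ (π ⟨$⟩ˡ γ)) (toℕ (π ⟨$⟩ˡ δ))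
    ... | tri< j<k _ _ = contradiction (trans (sym (sites γ)) (trans same (sites δ))) (<⇒≢ (final-site-< j<k))
    ... | tri≈ _ j≡k _ = j≡k
    ... | tri> _ _ k<j = contradiction (trans (sym (sites δ)) (trans (sym same) (sites γ))) (<⇒≢ (final-site-< k<j))

  final-reads : ReadsAs (State 0 h) π
  final-reads j k j<k = subst₂ _<_ (sym (trans (lookup-State 0 h j) (final-site _)))
                                   (sym (trans (lookup-State 0 h k) (final-site _))) (final-site-< j<k)

  initial-site-low : ∀ j → j < h → site p₁ 0 j ≡ suc (p₁ + j)
  initial-site-low j j<h = trans (site-low p₁ 0 j<h) (+-comm (p₁ + j) 1)

  initial-site-high : ∀ k → k < p → site p₁ 0 (h + k) ≡ suc k
  initial-site-high k k<p = trans (site-high p₁ 0 k) (waiting-or-moving (k <? p₁))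
    where
    waiting-or-moving : (d : Dec (k < p₁)) → (if? d then suc k else (if? (k ≟ p₁) then suc (p₁ + 0) else suc (h + k))) ≡ suc k
    waiting-or-moving (yes _) = refl
    waiting-or-moving (no k≮p₁) = trans (if?-yes (k ≟ p₁) k≡p₁) (cong suc (trans (+-identityʳ p₁) (sym k≡p₁)))
      where
      k≡p₁ : k ≡ p₁
      k≡p₁ = ≤-antisym (≤-pred k<p) (≮⇒≥ k≮p₁)

  initial∈𝒮 : InS n p (State p₁ 0)
  initial∈𝒮 = begin
    toList (State p₁ 0)                                   ≡⟨ toList-tabulate _ ⟩
    List.tabulate (site p₁ 0 ∘ toℕ ∘ (π ⟨$⟩ˡ_))           ↭⟨ tabulate-permute (site p₁ 0 ∘ toℕ) (Perm.flip π) ⟨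
    List.tabulate (site p₁ 0 ∘ toℕ)                       ≡⟨ tabulate-toℕ n (site p₁ 0) ⟩
    applyUpTo (site p₁ 0) n                               ≡⟨ cong (applyUpTo (site p₁ 0)) (sym h+p≡n) ⟩
    applyUpTo (site p₁ 0) (h + p)                         ≡⟨ applyUpTo-+ (site p₁ 0) h p ⟩
    applyUpTo (site p₁ 0) h List.++ applyUpTo (site p₁ 0 ∘ (h +_)) p
      ≡⟨ cong₂ List._++_ (applyUpTo-cong h initial-site-low)
                         (trans (applyUpTo-cong p initial-site-high) (sym (List.applyUpTo-∷ʳ suc p₁))) ⟩
    lows List.++ (highs List.∷ʳ p)                        ↭⟨ ++-comm lows (highs List.∷ʳ p) ⟩
    (highs List.∷ʳ p) List.++ lows                        ≡⟨ List.++-assoc highs List.[ p ] lows ⟩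
    highs List.++ List.[ p ] List.++ lows                 ↭⟨ shift p highs lows ⟩
    p List.∷ highs List.++ lows                           ≡⟨ cong (p List.∷_) (applyUpTo-+ suc p₁ h) ⟨
    p List.∷ applyUpTo suc (p₁ + h)                       ≡⟨ cong (λ m → p List.∷ applyUpTo suc m) n∸1≡p₁+h ⟨
    p List.∷ applyUpTo suc (n ∸ 1)                        ≡⟨ cong (p List.∷_) (List.map-upTo suc (n ∸ 1)) ⟨
    p List.∷ List.map suc (List.upTo (n ∸ 1))             ∎
    where
    open PermutationReasoning
    lows highs : List ℕ
    lows = applyUpTo (λ j → suc (p₁ + j)) h
    highs = applyUpTo suc p₁
    n∸1≡p₁+h : n ∸ 1 ≡ p₁ + h
    n∸1≡p₁+h = trans (cong (_∸ 1) (trans (sym h+p≡n) (+-suc h p₁))) (+-comm h p₁)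

  resultant : Resultant n p π
  resultant = State p₁ 0 , initial∈𝒮 , State 0 h , all-stages p₁ ≤-refl , final-stable , final-reads

resultant⇒prefix-initial : ∀ m p → p ≤ m → (π : Permutation′ (suc m)) → Resultant (suc m) p π → PrefixIsInitial (suc m) p π
resultant⇒prefix-initial m p p≤m π (C , C∈𝒮 , D , C↠D , stable , reads) =
  low-prefix , λ ℓ ℓ<h → π ⟨$⟩ˡ ℓ , prefix-onto π h≤n low-prefix ℓ ℓ<h , inverseʳ π
  where
  h : ℕ
  h = suc m ∸ p
  h≤n : h ≤ suc m
  h≤n = m∸n≤m (suc m) p
  open StableBalanced h D (balanced-topples h C↠D (InitialConfig.balanced m p p≤m C C∈𝒮)) stable
  low-prefix : ∀ j → toℕ j < h → toℕ (π ⟨$⟩ʳ j) < h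
  low-prefix = low-labels-first π h≤n λ j k j<k πj-high πk-low → high-before-low _ _ πj-high πk-low (reads j k j<k)

prefix-initial⇒resultant : ∀ n p₁ → suc p₁ ≤ n → (π : Permutation′ n) →
                           PrefixIsInitial n (suc p₁) π → Resultant n (suc p₁) π
prefix-initial⇒resultant n p₁ p≤n π (low-prefix , low-onto) =
  FiringSchedule.resultant n h p₁ (m∸n+n≡m p≤n) π low-prefix high-suffix
  where
  h : ℕ
  h = n ∸ suc p₁
  high-suffix : ∀ j → h ≤ toℕ j → h ≤ toℕ (π ⟨$⟩ʳ j)
  high-suffix j h≤j with toℕ (π ⟨$⟩ʳ j) <? h
  ... | no πj≮h = ≮⇒≥ πj≮h
  ... | yes πj<h with j′ , j′<h , πj′≡πj ← low-onto (π ⟨$⟩ʳ j) πj<h =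
    contradiction (subst (λ k → toℕ k < h) (Injection.injective (↔⇒↣ π) πj′≡πj) j′<h) (≤⇒≯ h≤j)

theorem2p10 : (n p : ℕ) → 2 ≤ n → 1 ≤ p → p ≤ n ∸ 1 →
    (π : Permutation′ n) → Resultant n p π ⇔ PrefixIsInitial n p π
theorem2p10 (suc m) (suc p₁) _ _ p≤m π =
  mk⇔ (resultant⇒prefix-initial m (suc p₁) p≤m π) (prefix-initial⇒resultant (suc m) p₁ (m≤n⇒m≤1+n p≤m) π)
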